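{- (i) Let $G$ be a $6$-minimal graph with maximum degree at most $3$ and girth at least $7$. Then $G$ does not contain a vertex $v_1$ of class $3$ and a vertex $v_2$ of class $2$ or class $3$ such that $v_1$ and $v_2$ have a common neighbor $u_3$. (ii) Moreover, let $G$ be any graph with maximum degree at most $3$ and girth at least $7$ containing such vertices $v_1,v_2,u_3$, and let $L$ be an assignment of lists of size $6$ to $V(G)$. If $G^2-u_3$ has a proper $L$-coloring, then $G^2$ has two proper $L$-colorings $\phi$ and $\psi$ with $\phi(u_3)\ne\psi(u_3)$.
   Context: All graphs are finite and simple. The square $G^2$ of $G$ has vertex set $V(G)$, with two vertices adjacent if their distance in $G$ is at most $2$; $G^2-u_3$ denotes $G^2$ with the vertex $u_3$ deleted. An $L$-coloring is a coloring assigning to each vertex $w$ a color from $L(w)$. A graph is $k$-choosable if it admits a proper coloring from any assignment of lists of size $k$. A graph $G$ is $k$-minimal if $G^2$ is not $k$-choosable but $H^2$ is $k$-choosable for every proper subgraph $H$ of $G$. A vertex of degree $3$ is of class $i$ if it is adjacent to exactly $i$ vertices of degree $2$. -}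

module Defs where

open import Data.Nat using (ℕ; _≤_; _≥_; _<_)
import Data.Nat
open import Data.Fin using (toℕ)
open import Data.Fin using (Fin)
open import Data.Fin.Properties using (_≟_)
open import Data.List using (List; length; filter; allFin)
open import Data.List.Membership.Propositional using (_∈_)
open import Data.List.Relation.Unary.Unique.Propositional using (Unique)
open import Data.Vec using (Vec; lookup; _∷_; [])
open import Data.Product using (Σ; _×_; ∃)
open import Data.Sum using (_⊎_)
open import Data.Empty using (⊥)
open import Relation.Nullary using (¬_; Dec)
open import Relation.Nullary.Decidable using (_×-dec_)
open import Relation.Binary.PropositionalEquality using (_≡_; _≢_)
open import Function.Definitions using (Injective)
import Data.Nat.Properties as ℕP

record Graph (n : ℕ) : Set₁ where
  field
    Adj    : Fin n → Fin n → Set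
    adj?   : ∀ u v → Dec (Adj u v)
    sym    : ∀ {u v} → Adj u v → Adj v u
    irrefl : ∀ {v} → ¬ Adj v v

module _ {n : ℕ} (G : Graph n) where
  open Graph G

  deg : Fin n → ℕ
  deg v = length (filter (λ w → adj? v w) (allFin n))

  MaxDegreeAtMost : ℕ → Set
  MaxDegreeAtMost d = ∀ v → deg v ≤ d

  deg2Nbrs : Fin n → ℕ
  deg2Nbrs v = length (filter (λ w → adj? v w ×-dec (deg w ℕP.≟ 2)) (allFin n))

  OfClass : ℕ → Fin n → Set
  OfClass i v = deg v ≡ 3 × deg2Nbrs v ≡ i

  record Cycle (k : ℕ) : Set where
    field
      k≥3      : k ≥ 3
      verts    : Fin k → Fin n
      distinct : Injective _≡_ _≡_ verts
      closed   : ∀ (i j : Fin k) → (toℕ j ≡ Data.Nat.suc (toℕ i) ⊎ (toℕ i ≡ k Data.Nat.∸ 1 × toℕ j ≡ 0)) →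
                 Adj (verts i) (verts j)

  GirthAtLeast : ℕ → Set
  GirthAtLeast g = ∀ k → k < g → ¬ Cycle k

record Subgraph {n : ℕ} (G : Graph n) : Set₁ where
  open Graph G
  field
    InV   : Fin n → Set
    InE   : Fin n → Fin n → Set
    E⊆Adj : ∀ {u v} → InE u v → Adj u v
    Esym  : ∀ {u v} → InE u v → InE v u
    Eends : ∀ {u v} → InE u v → InV u × InV v

Proper : ∀ {n} {G : Graph n} → Subgraph G → Set
Proper {n} {G} H =
  ¬ ((∀ v → Subgraph.InV H v) × (∀ u v → Graph.Adj G u v → Subgraph.InE H u v))

SqAdj : ∀ {n} → (Fin n → Fin n → Set) → Fin n → Fin n → Set
SqAdj {n} E u v = u ≢ v × (E u v ⊎ Σ (Fin n) (λ w → E u w × E w v))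

IsKListAssignment : ∀ {n} → ℕ → (Fin n → List ℕ) → Set
IsKListAssignment k L = ∀ v → length (L v) ≡ k × Unique (L v)

ProperLColoring : ∀ {n} → (Fin n → Set) → (Fin n → Fin n → Set) →
                  (Fin n → List ℕ) → (Fin n → ℕ) → Set
ProperLColoring {n} V A L c =
  (∀ v → V v → c v ∈ L v) × (∀ u v → V u → V v → A u v → c u ≢ c v)

Choosable : ∀ {n} → ℕ → (Fin n → Set) → (Fin n → Fin n → Set) → Set
Choosable {n} k V A =
  ∀ (L : Fin n → List ℕ) → IsKListAssignment k L → ∃ λ c → ProperLColoring V A L c

AllV : ∀ {n} → Fin n → Set
AllV _ = Data.Unit.⊤
  where import Data.Unit

SquareChoosable : ∀ {n} → ℕ → Graph n → Set
SquareChoosable k G = Choosable k AllV (SqAdj (Graph.Adj G))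

SubSquareChoosable : ∀ {n} {G : Graph n} → ℕ → Subgraph G → Set
SubSquareChoosable k H = Choosable k (Subgraph.InV H) (SqAdj (Subgraph.InE H))

Minimal : ∀ {n} → ℕ → Graph n → Set₁
Minimal k G = ¬ SquareChoosable k G × (∀ (H : Subgraph G) → Proper H → SubSquareChoosable k H)

Config : ∀ {n} → Graph n → Fin n → Fin n → Fin n → Set
Config G v1 v2 u3 =
  v1 ≢ v2 × OfClass G 3 v1 × (OfClass G 2 v2 ⊎ OfClass G 3 v2) ×
  Graph.Adj G v1 u3 × Graph.Adj G v2 u3

-- Let a, b be the other neighbours of v₁, c a degree-2 neighbour of v₂ other than u₃, and
-- S = {u₃, v₁, a, b, c, v₂}. Girth at least 7 makes the square of G induced on S have exactly the
-- ten edges of Edge, and u₃, v₁, a, b, c, v₂ have at most 1, 2, 3, 3, 4, 4 square-neighbours outside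
-- S. Hence a colouring of G² outside S leaves lists of sizes 4, 4, 3, 3, 2, 2 on S even when u₃ must
-- also avoid one prescribed colour, and S can be coloured greedily from such lists. A colouring of
-- (G − u₃)² is proper for G² outside S, which gives (i); extending a colouring of G² − u₃ twice, the
-- second time avoiding the first colour of u₃, gives (ii).

module Submission where

open import Defs
open import Data.Nat using (ℕ; zero; suc; _+_; _∸_; _≤_; _<_; z≤n; s≤s)
open import Data.Nat.Properties
  using (suc-injective; ≤-refl; ≤-reflexive; ≤-trans; ≤-pred; ≤-<-trans; <-≤-trans; <-irrefl; <⇒≱; <⇒≢; m≤n+m; +-suc; +-monoʳ-≤; ≤ᵇ⇒≤)
  renaming (_≟_ to _≟ℕ_)
open import Data.Fin using (Fin; zero; suc; toℕ)
open import Data.Fin.Properties using (_≟_)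
open import Data.List using (List; []; _∷_; length; filter; map; allFin)
open import Data.List.Properties using (filter-notAll; length-map)
open import Data.List.Membership.Propositional using (_∈_; _∉_; find; lose)
open import Data.List.Membership.Propositional.Properties using (∈-filter⁺; ∈-filter⁻; ∈-allFin; ∈-map⁺; ∈-map⁻)
open import Data.List.Relation.Binary.Subset.Propositional using (_⊆_)
open import Data.List.Relation.Unary.Unique.Propositional using (Unique)
open import Data.List.Relation.Unary.Unique.Propositional.Properties using (filter⁺; allFin⁺)
open import Data.List.Relation.Unary.AllPairs using ([]; _∷_)
open import Data.List.Relation.Unary.All as All using ([]; _∷_)
open import Data.List.Relation.Unary.All.Properties using (¬Any⇒All¬)
open import Data.List.Relation.Unary.Any as Any using (here; there; any?)
open import Data.Vec using (Vec; []; _∷_; lookup; _∷ʳ_)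
open import Data.Vec.Relation.Unary.Linked using (Linked; _∷_; [-])
open import Data.Vec.Relation.Unary.AllPairs using ([]; _∷_)
open import Data.Vec.Relation.Unary.All using ([]; _∷_)
import Data.Vec.Relation.Unary.Unique.Propositional as Vec
open import Data.Vec.Relation.Unary.Unique.Propositional.Properties using (lookup-injective)
open import Data.Product using (Σ; ∃; _×_; _,_; proj₁; proj₂)
open import Data.Sum using (_⊎_; inj₁; inj₂; [_,_]′)
open import Data.Empty using (⊥-elim)
open import Function using (_∘_)
open import Relation.Nullary using (¬_; yes; no; ¬?)
open import Relation.Nullary.Decidable using (decidable-stable; _×-dec_)
open import Relation.Nullary.Negation using (contradiction)
open import Relation.Binary.Definitions using (DecidableEquality)
open import Relation.Binary.PropositionalEquality using (_≡_; _≢_; refl; sym; trans; cong; subst; ≢-sym)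

module _ {X : Set} (_≟_ : DecidableEquality X) where
  open import Data.List.Membership.DecPropositional _≟_ using (_∈?_)

  without : X → List X → List X
  without x = filter (¬? ∘ (x ≟_))

  length-without : ∀ {x} {ys : List X} → x ∈ ys → length (without x ys) < length ys
  length-without {ys = ys} x∈ys = filter-notAll (¬? ∘ (_ ≟_)) ys (Any.map (λ x≡y x≢y → x≢y x≡y) x∈ys)

  ∈-without⁺ : ∀ {x y} {ys : List X} → y ∈ ys → x ≢ y → y ∈ without x ys
  ∈-without⁺ {x} = ∈-filter⁺ (¬? ∘ (x ≟_))

  ⊆-without : ∀ {x} {xs ys : List X} → x ∉ xs → xs ⊆ ys → xs ⊆ without x ys
  ⊆-without x∉xs xs⊆ys z∈xs = ∈-without⁺ (xs⊆ys z∈xs) λ { refl → x∉xs z∈xs }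

  length-≤-⊆ : ∀ {xs ys : List X} → Unique xs → xs ⊆ ys → length xs ≤ length ys
  length-≤-⊆ {[]} _ _ = z≤n
  length-≤-⊆ {x ∷ xs} (x≢xs ∷ xs!) x∷xs⊆ys =
    ≤-trans (s≤s (length-≤-⊆ xs! (⊆-without x∉xs (x∷xs⊆ys ∘ there)))) (length-without (x∷xs⊆ys (here refl)))
    where
    x∉xs : x ∉ xs
    x∉xs x∈xs = All.lookup x≢xs x∈xs refl

  ∃-∉ : ∀ {xs ys : List X} → Unique xs → length ys < length xs → ∃ λ x → x ∈ xs × x ∉ ys
  ∃-∉ {xs} {ys} xs! ys<xs with any? (λ x → ¬? (x ∈? ys)) xs
  ... | yes found = find found
  ... | no none = contradiction (length-≤-⊆ xs! xs⊆ys) (<⇒≱ ys<xs)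
    where
    xs⊆ys : xs ⊆ ys
    xs⊆ys {x} x∈xs = decidable-stable (x ∈? ys) (none ∘ lose x∈xs)

  ⊆-by-length : ∀ {xs ys : List X} → Unique xs → xs ⊆ ys → length ys ≤ length xs → ys ⊆ xs
  ⊆-by-length {xs} {ys} xs! xs⊆ys ys≤xs {y} y∈ys with y ∈? xs
  ... | yes y∈xs = y∈xs
  ... | no y∉xs = contradiction
        (≤-<-trans (length-≤-⊆ xs! (⊆-without y∉xs xs⊆ys)) (<-≤-trans (length-without y∈ys) ys≤xs))
        (<-irrefl refl)

  record Palette (k : ℕ) (xs ys : List X) : Set where
    field
      colours : List X
      unique  : Unique colours
      length≡ : length colours ≡ k
      sound   : ∀ {z} → z ∈ colours → z ∈ xs × z ∉ ys

  palette : ∀ k {xs ys : List X} → Unique xs → k + length ys ≤ length xs → Palette k xs ys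
  palette zero _ _ = record { colours = [] ; unique = [] ; length≡ = refl ; sound = λ () }
  palette (suc k) {xs} {ys} xs! room with ∃-∉ xs! (≤-trans (s≤s (m≤n+m _ k)) room)
  ... | x , x∈xs , x∉ys = record
    { colours = x ∷ colours
    ; unique = All.tabulate x≢ ∷ unique
    ; length≡ = cong suc length≡
    ; sound = x∷P⊆ }
    where
    open Palette (palette k {ys = x ∷ ys} xs! (subst (_≤ length xs) (sym (+-suc k (length ys))) room))
    x≢ : ∀ {z} → z ∈ colours → x ≢ z
    x≢ z∈P x≡z = proj₂ (sound z∈P) (here (sym x≡z))
    x∷P⊆ : ∀ {z} → z ∈ x ∷ colours → z ∈ xs × z ∉ ys
    x∷P⊆ (here refl) = x∈xs , x∉ys
    x∷P⊆ (there z∈P) = proj₁ (sound z∈P) , proj₂ (sound z∈P) ∘ there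

data Node : Set where
  U V₁ A B C V₂ : Node

data Edge : Node → Node → Set where
  UV₁ : Edge U V₁
  UA  : Edge U A
  UB  : Edge U B
  UC  : Edge U C
  UV₂ : Edge U V₂
  V₁A : Edge V₁ A
  V₁B : Edge V₁ B
  AB  : Edge A B
  V₁V₂ : Edge V₁ V₂
  V₂C : Edge V₂ C

by-node : ∀ {F : Node → Set} → F U → F V₁ → F A → F B → F C → F V₂ → ∀ p → F p
by-node u v₁ a b c v₂ U  = u
by-node u v₁ a b c v₂ V₁ = v₁
by-node u v₁ a b c v₂ A  = a
by-node u v₁ a b c v₂ B  = b
by-node u v₁ a b c v₂ C  = c
by-node u v₁ a b c v₂ V₂ = v₂

nodes : List Node
nodes = U ∷ V₁ ∷ A ∷ B ∷ C ∷ V₂ ∷ []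

∈-nodes : ∀ p → p ∈ nodes
∈-nodes = by-node (here refl) (there (here refl)) (there (there (here refl)))
  (there (there (there (here refl)))) (there (there (there (there (here refl)))))
  (there (there (there (there (there (here refl))))))

size : Node → ℕ
size U  = 4
size V₁ = 4
size A  = 3
size B  = 3
size C  = 2
size V₂ = 2

Colouring : ∀ {Colour : Set} → (Node → List Colour) → Set
Colouring {Colour} P = Σ (Node → Colour) λ col → (∀ p → col p ∈ P p) × (∀ {p q} → Edge p q → col p ≢ col q)

module _ {Colour : Set} (_≟_ : DecidableEquality Colour) where
  open import Data.List.Membership.DecPropositional _≟_ using (_∈?_)

  module _ (P : Node → List Colour) (P! : ∀ p → Unique (P p)) (|P| : ∀ p → length (P p) ≡ size p) where

    private
      choose : ∀ p (F : List Colour) → length F < size p → ∃ λ z → z ∈ P p × z ∉ F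
      choose p F F<p = ∃-∉ _≟_ (P! p) (subst (length F <_) (sym (|P| p)) F<p)

    colouring-separated : ∀ {cB} → cB ∈ P B → cB ∉ P A → Colouring P
    colouring-separated {cB} cB∈ cB∉A with choose V₂ [] (s≤s z≤n)
    ... | cV₂ , cV₂∈ , _ with choose C (cV₂ ∷ []) ≤-refl
    ... | cC , cC∈ , cC∉ with choose U (cB ∷ cV₂ ∷ cC ∷ []) ≤-refl
    ... | cU , cU∈ , cU∉ with choose V₁ (cB ∷ cV₂ ∷ cU ∷ []) ≤-refl
    ... | cV₁ , cV₁∈ , cV₁∉ with choose A (cU ∷ cV₁ ∷ []) ≤-refl
    ... | cA , cA∈ , cA∉ = col , member , proper
      where
      col : Node → Colour
      col = by-node cU cV₁ cA cB cC cV₂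
      member : ∀ p → col p ∈ P p
      member = by-node cU∈ cV₁∈ cA∈ cB∈ cC∈ cV₂∈
      proper : ∀ {p q} → Edge p q → col p ≢ col q
      proper UV₁ = cV₁∉ ∘ there ∘ there ∘ here ∘ sym
      proper UA = cA∉ ∘ here ∘ sym
      proper UB = cU∉ ∘ here
      proper UC = cU∉ ∘ there ∘ there ∘ here
      proper UV₂ = cU∉ ∘ there ∘ here
      proper V₁A = cA∉ ∘ there ∘ here ∘ sym
      proper V₁B = cV₁∉ ∘ here
      proper AB cA≡cB = cB∉A (subst (_∈ P A) cA≡cB cA∈)
      proper V₁V₂ = cV₁∉ ∘ there ∘ here
      proper V₂C = cC∉ ∘ here ∘ sym

    colouring-nested : P B ⊆ P A → Colouring P
    colouring-nested B⊆A with choose V₁ (P A) (subst (_< 4) (sym (|P| A)) ≤-refl)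
    ... | cV₁ , cV₁∈ , cV₁∉A with choose V₂ (cV₁ ∷ []) ≤-refl
    ... | cV₂ , cV₂∈ , cV₂∉ with choose C (cV₂ ∷ []) ≤-refl
    ... | cC , cC∈ , cC∉ with choose U (cV₁ ∷ cV₂ ∷ cC ∷ []) ≤-refl
    ... | cU , cU∈ , cU∉ with choose A (cU ∷ []) (s≤s (s≤s z≤n))
    ... | cA , cA∈ , cA∉ with choose B (cU ∷ cA ∷ []) ≤-refl
    ... | cB , cB∈ , cB∉ = col , member , proper
      where
      col : Node → Colour
      col = by-node cU cV₁ cA cB cC cV₂
      member : ∀ p → col p ∈ P p
      member = by-node cU∈ cV₁∈ cA∈ cB∈ cC∈ cV₂∈
      proper : ∀ {p q} → Edge p q → col p ≢ col q
      proper UV₁ = cU∉ ∘ here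
      proper UA = cA∉ ∘ here ∘ sym
      proper UB = cB∉ ∘ here ∘ sym
      proper UC = cU∉ ∘ there ∘ there ∘ here
      proper UV₂ = cU∉ ∘ there ∘ here
      proper V₁A cV₁≡cA = cV₁∉A (subst (_∈ P A) (sym cV₁≡cA) cA∈)
      proper V₁B cV₁≡cB = cV₁∉A (subst (_∈ P A) (sym cV₁≡cB) (B⊆A cB∈))
      proper AB = cB∉ ∘ there ∘ here ∘ sym
      proper V₁V₂ = cV₂∉ ∘ here ∘ sym
      proper V₂C = cC∉ ∘ here ∘ sym

    -- If b can take a colour outside a's list, a and b never clash; otherwise a colour of v₁
    -- outside a's list clashes with neither of them.
    configuration-choosable : Colouring P
    configuration-choosable with any? (λ z → ¬? (z ∈? P A)) (P B)
    ... | yes B⊈A = let cB , cB∈ , cB∉A = find B⊈A in colouring-separated cB∈ cB∉A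
    ... | no B⊆A = colouring-nested λ {z} z∈B → decidable-stable (z ∈? P A) (All.lookup (¬Any⇒All¬ (P B) B⊆A) z∈B)

module Gluing {V K : Set} (_≟_ : DecidableEquality V) (ι : K → V)
              (nodes : List K) (∈-nodes : ∀ p → p ∈ nodes) where

  Outside : V → Set
  Outside x = ∀ p → ι p ≢ x

  outside-∉ : ∀ {y} → Outside y → ∀ ps → y ∉ map ι ps
  outside-∉ out ps y∈ with ∈-map⁻ ι {xs = ps} y∈
  ... | p , _ , y≡ιp = out p (sym y≡ιp)

  outside-head : ∀ {y z} → Outside y → ∀ ps → y ∈ z ∷ map ι ps → y ≡ z
  outside-head out ps (here y≡z) = y≡z
  outside-head out ps (there y∈) = ⊥-elim (outside-∉ out ps y∈)

  data Located (x : V) : Set where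
    inside  : ∀ p → ι p ≡ x → Located x
    outside : Outside x → Located x

  locate : ∀ x → Located x
  locate x with any? (λ p → ι p ≟ x) nodes
  ... | yes found = let p , _ , ιp≡x = find found in inside p ιp≡x
  ... | no none = outside λ p ιp≡x → none (lose (∈-nodes p) ιp≡x)

  module _ {Colour : Set} (col : K → Colour) (f : V → Colour) where

    colour-at : ∀ {x} → Located x → Colour
    colour-at (inside p _) = col p
    colour-at {x} (outside _) = f x

    glue : V → Colour
    glue x = colour-at (locate x)

    glue-∈ : (L : V → List Colour) → (∀ p → col p ∈ L (ι p)) → (∀ x → Outside x → f x ∈ L x) →
             ∀ x → glue x ∈ L x
    glue-∈ L col∈ f∈ x = at (locate x)
      where
      at : ∀ {x} (l : Located x) → colour-at l ∈ L x
      at (inside p refl) = col∈ p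
      at {x} (outside out) = f∈ x out

    glue-inside : ∀ {P : Colour → Set} p → (∀ q → ι q ≡ ι p → P (col q)) → P (glue (ι p))
    glue-inside {P} p P-col = at (locate (ι p))
      where
      at : (l : Located (ι p)) → P (colour-at l)
      at (inside q ιq≡ιp) = P-col q ιq≡ιp
      at (outside out) = ⊥-elim (out p refl)

    glue-proper : (R : V → V → Set) → (∀ {x y} → R x y → R y x) →
                  (∀ {p q} → R (ι p) (ι q) → col p ≢ col q) →
                  (∀ {p y} → Outside y → R (ι p) y → col p ≢ f y) →
                  (∀ {x y} → Outside x → Outside y → R x y → f x ≢ f y) →
                  ∀ {x y} → R x y → glue x ≢ glue y
    glue-proper R R-sym col-proper col≢f f-proper {x} {y} = at (locate x) (locate y)
      where
      at : ∀ {x y} (lx : Located x) (ly : Located y) → R x y → colour-at lx ≢ colour-at ly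
      at (inside p refl) (inside q refl) Rxy = col-proper Rxy
      at (inside p refl) (outside out) Rxy = col≢f out Rxy
      at (outside out) (inside q refl) Rxy = col≢f out (R-sym Rxy) ∘ sym
      at (outside out) (outside out′) Rxy = f-proper out out′ Rxy

module _ {X : Set} {R : X → X → Set} where

  linked-step : ∀ {k} (ys : Vec X k) {z} → Linked R (ys ∷ʳ z) →
                ∀ i j → toℕ j ≡ suc (toℕ i) → R (lookup ys i) (lookup ys j)
  linked-step (y ∷ y′ ∷ ys) (r ∷ _) zero (suc zero) refl = r
  linked-step (y ∷ ys) (_ ∷ rs) (suc i) (suc j) j≡1+i = linked-step ys rs i j (suc-injective j≡1+i)

  linked-wrap : ∀ {k} (ys : Vec X (suc k)) {z} → Linked R (ys ∷ʳ z) →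
                ∀ i → toℕ i ≡ k → R (lookup ys i) z
  linked-wrap (y ∷ []) (r ∷ _) zero refl = r
  linked-wrap (y ∷ y′ ∷ ys) (_ ∷ rs) (suc i) i≡k = linked-wrap (y′ ∷ ys) rs i (suc-injective i≡k)

module _ {n : ℕ} (G : Graph n) where
  open Graph G renaming (sym to adj-sym)

  closed-walk-cycle : ∀ {k} (x : Fin n) (xs : Vec (Fin n) (suc (suc k))) →
                      Vec.Unique (x ∷ xs) → Linked Adj ((x ∷ xs) ∷ʳ x) → Cycle G (3 + k)
  closed-walk-cycle {k} x xs x∷xs! walk = record
    { k≥3 = s≤s (s≤s (s≤s z≤n))
    ; verts = lookup (x ∷ xs)
    ; distinct = λ {i} {j} → lookup-injective x∷xs! i j
    ; closed = closed }
    where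
    closed : ∀ i j → toℕ j ≡ suc (toℕ i) ⊎ (toℕ i ≡ 3 + k ∸ 1 × toℕ j ≡ 0) →
             Adj (lookup (x ∷ xs) i) (lookup (x ∷ xs) j)
    closed i j (inj₁ j≡1+i) = linked-step (x ∷ xs) walk i j j≡1+i
    closed i zero (inj₂ (i≡last , _)) = linked-wrap (x ∷ xs) walk i i≡last

  nbrs : Fin n → List (Fin n)
  nbrs x = filter (adj? x) (allFin n)

  nbrs-unique : ∀ x → Unique (nbrs x)
  nbrs-unique x = filter⁺ (adj? x) (allFin⁺ n)

  ∈-nbrs⁺ : ∀ {x y} → Adj x y → y ∈ nbrs x
  ∈-nbrs⁺ {x} {y} xy = ∈-filter⁺ (adj? x) (∈-allFin y) xy

  ∈-nbrs⁻ : ∀ {x y} → y ∈ nbrs x → Adj x y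
  ∈-nbrs⁻ {x} y∈ = proj₂ (∈-filter⁻ (adj? x) {xs = allFin n} y∈)

  nbrs₂ : Fin n → List (Fin n)
  nbrs₂ x = filter (λ w → adj? x w ×-dec (deg G w ≟ℕ 2)) (allFin n)

  nbrs₂-unique : ∀ x → Unique (nbrs₂ x)
  nbrs₂-unique x = filter⁺ (λ w → adj? x w ×-dec (deg G w ≟ℕ 2)) (allFin⁺ n)

  ∈-nbrs₂⁻ : ∀ {x y} → y ∈ nbrs₂ x → Adj x y × deg G y ≡ 2
  ∈-nbrs₂⁻ {x} y∈ = proj₂ (∈-filter⁻ (λ w → adj? x w ×-dec (deg G w ≟ℕ 2)) {xs = allFin n} y∈)

  new-neighbour : ∀ {x} (ys : List (Fin n)) → length ys < deg G x → ∃ λ y → Adj x y × y ∉ ys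
  new-neighbour {x} ys ys<deg with ∃-∉ _≟_ (nbrs-unique x) ys<deg
  ... | y , y∈ , y∉ = y , ∈-nbrs⁻ y∈ , y∉

  neighbours-listed : ∀ {x} {ys : List (Fin n)} → Unique ys → (∀ {y} → y ∈ ys → Adj x y) →
                      deg G x ≤ length ys → ∀ {y} → Adj x y → y ∈ ys
  neighbours-listed ys! ys-adj deg≤ xy = ⊆-by-length _≟_ ys! (∈-nbrs⁺ ∘ ys-adj) deg≤ (∈-nbrs⁺ xy)

  last-neighbour : ∀ {x} {ys : List (Fin n)} → Unique ys → (∀ {y} → y ∈ ys → Adj x y) →
                   deg G x ≡ suc (length ys) →
                   ∃ λ z → Adj x z × z ∉ ys × (∀ {w} → Adj x w → w ∈ z ∷ ys)
  last-neighbour {x} {ys} ys! ys-adj deg≡ with new-neighbour ys (subst (length ys <_) (sym deg≡) ≤-refl)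
  ... | z , xz , z∉ys = z , xz , z∉ys , neighbours-listed z∷ys! z∷ys-adj (≤-reflexive deg≡)
    where
    z∷ys! : Unique (z ∷ ys)
    z∷ys! = All.tabulate (λ y∈ys z≡y → z∉ys (subst (_∈ ys) (sym z≡y) y∈ys)) ∷ ys!
    z∷ys-adj : ∀ {y} → y ∈ z ∷ ys → Adj x y
    z∷ys-adj (here refl) = xz
    z∷ys-adj (there y∈ys) = ys-adj y∈ys

  class-full : ∀ {x y} → deg2Nbrs G x ≡ deg G x → Adj x y → deg G y ≡ 2
  class-full {x} {y} full xy with deg G y ≟ℕ 2
  ... | yes two = two
  ... | no ¬two = contradiction full (<⇒≢ (≤-<-trans
        (length-≤-⊆ _≟_ (nbrs₂-unique x) (⊆-without _≟_ y∉nbrs₂ (∈-nbrs⁺ ∘ proj₁ ∘ ∈-nbrs₂⁻)))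
        (length-without _≟_ (∈-nbrs⁺ xy))))
    where
    y∉nbrs₂ : y ∉ nbrs₂ x
    y∉nbrs₂ = ¬two ∘ proj₂ ∘ ∈-nbrs₂⁻

  class-3-neighbour : ∀ {x y} → OfClass G 3 x → Adj x y → deg G y ≡ 2
  class-3-neighbour (deg≡3 , count≡3) = class-full (trans count≡3 (sym deg≡3))

  SqAdj-sym : ∀ {x y} → SqAdj Adj x y → SqAdj Adj y x
  SqAdj-sym (x≢y , inj₁ xy) = x≢y ∘ sym , inj₁ (adj-sym xy)
  SqAdj-sym (x≢y , inj₂ (w , xw , wy)) = x≢y ∘ sym , inj₂ (w , adj-sym wy , adj-sym xw)

  other-neighbour : ∀ {x y} → deg G x ≡ 2 → Adj x y → ∃ λ z → Adj x z × (∀ {w} → Adj x w → w ∈ z ∷ y ∷ [])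
  other-neighbour deg≡2 xy with last-neighbour ([] ∷ []) (λ { (here refl) → xy }) deg≡2
  ... | z , xz , _ , N[x] = z , xz , N[x]

  other-neighbours : ∀ {x y} → deg G x ≡ 3 → Adj x y →
    ∃ λ z → ∃ λ w → Adj x z × Adj x w × y ≢ z × y ≢ w × (∀ {t} → Adj x t → t ∈ w ∷ z ∷ y ∷ [])
  other-neighbours {x} {y} deg≡3 xy with new-neighbour (y ∷ []) (subst (1 <_) (sym deg≡3) (s≤s (s≤s z≤n)))
  ... | z , xz , z∉ with last-neighbour ((z≢y ∷ []) ∷ [] ∷ []) adj-z,y deg≡3
    where
    z≢y : z ≢ y
    z≢y = z∉ ∘ here
    adj-z,y : ∀ {t} → t ∈ z ∷ y ∷ [] → Adj x t
    adj-z,y (here refl) = xz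
    adj-z,y (there (here refl)) = xy
  ... | w , xw , w∉ , N[x] = z , w , xz , xw , z∉ ∘ here ∘ sym , w∉ ∘ there ∘ here ∘ sym , N[x]

  another-deg₂-neighbour : ∀ {x} y → 1 < deg2Nbrs G x → ∃ λ z → Adj x z × deg G z ≡ 2 × y ≢ z
  another-deg₂-neighbour {x} y 1<count with ∃-∉ _≟_ {ys = y ∷ []} (nbrs₂-unique x) 1<count
  ... | z , z∈ , z∉ = z , proj₁ (∈-nbrs₂⁻ z∈) , proj₂ (∈-nbrs₂⁻ z∈) , z∉ ∘ here ∘ sym


record Surroundings {n : ℕ} (G : Graph n) (v₁ v₂ u : Fin n) : Set where
  open Graph G
  field
    a b c d a′ b′ c′ : Fin n
    v₁≢v₂ : v₁ ≢ v₂
    u≢a : u ≢ a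
    u≢b : u ≢ b
    u≢c : u ≢ c
    deg-v₁ : deg G v₁ ≡ 3
    deg-v₂ : deg G v₂ ≡ 3
    deg-a : deg G a ≡ 2
    deg-b : deg G b ≡ 2
    deg-c : deg G c ≡ 2
    v₁u : Adj v₁ u
    v₂u : Adj v₂ u
    v₁a : Adj v₁ a
    v₁b : Adj v₁ b
    v₂c : Adj v₂ c
    v₂d : Adj v₂ d
    aa′ : Adj a a′
    bb′ : Adj b b′
    cc′ : Adj c c′
    N[u]  : ∀ {w} → Adj u w → w ∈ v₁ ∷ v₂ ∷ []
    N[v₁] : ∀ {w} → Adj v₁ w → w ∈ b ∷ a ∷ u ∷ []
    N[v₂] : ∀ {w} → Adj v₂ w → w ∈ d ∷ c ∷ u ∷ []
    N[a]  : ∀ {w} → Adj a w → w ∈ a′ ∷ v₁ ∷ []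
    N[b]  : ∀ {w} → Adj b w → w ∈ b′ ∷ v₁ ∷ []
    N[c]  : ∀ {w} → Adj c w → w ∈ c′ ∷ v₂ ∷ []

surroundings : ∀ {n} (G : Graph n) {v₁ v₂ u} → Config G v₁ v₂ u → Surroundings G v₁ v₂ u
surroundings G {v₁} {v₂} {u} (v₁≢v₂ , class₃@(deg-v₁ , _) , class-v₂ , v₁u , v₂u)
  with other-neighbours G deg-v₁ v₁u
... | a , b , v₁a , v₁b , u≢a , u≢b , N[v₁]
  with another-deg₂-neighbour G u (two-deg₂-neighbours class-v₂)
  where
  two-deg₂-neighbours : OfClass G 2 v₂ ⊎ OfClass G 3 v₂ → 1 < deg2Nbrs G v₂
  two-deg₂-neighbours (inj₁ (_ , count≡2)) = ≤-reflexive (sym count≡2)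
  two-deg₂-neighbours (inj₂ (_ , count≡3)) = subst (1 <_) (sym count≡3) (s≤s (s≤s z≤n))
... | c , v₂c , deg-c , u≢c
  with last-neighbour G ((≢-sym u≢c ∷ []) ∷ [] ∷ []) adj-c,u ([ proj₁ , proj₁ ]′ class-v₂)
  where
  adj-c,u : ∀ {y} → y ∈ c ∷ u ∷ [] → Graph.Adj G v₂ y
  adj-c,u (here refl) = v₂c
  adj-c,u (there (here refl)) = v₂u
... | d , v₂d , _ , N[v₂]
  with other-neighbour G (class-3-neighbour G class₃ v₁a) (Graph.sym G v₁a)
     | other-neighbour G (class-3-neighbour G class₃ v₁b) (Graph.sym G v₁b)
     | other-neighbour G deg-c (Graph.sym G v₂c)
... | a′ , aa′ , N[a] | b′ , bb′ , N[b] | c′ , cc′ , N[c] = record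
  { v₁≢v₂ = v₁≢v₂ ; u≢a = u≢a ; u≢b = u≢b ; u≢c = u≢c
  ; deg-v₁ = deg-v₁ ; deg-v₂ = [ proj₁ , proj₁ ]′ class-v₂
  ; deg-a = class-3-neighbour G class₃ v₁a ; deg-b = class-3-neighbour G class₃ v₁b ; deg-c = deg-c
  ; v₁u = v₁u ; v₂u = v₂u ; v₁a = v₁a ; v₁b = v₁b ; v₂c = v₂c ; v₂d = v₂d
  ; aa′ = aa′ ; bb′ = bb′ ; cc′ = cc′
  ; N[u] = neighbours-listed G ((v₁≢v₂ ∷ []) ∷ [] ∷ []) adj-v₁,v₂ (≤-reflexive (class-3-neighbour G class₃ v₁u))
  ; N[v₁] = N[v₁] ; N[v₂] = N[v₂] ; N[a] = N[a] ; N[b] = N[b] ; N[c] = N[c] }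
  where
  adj-v₁,v₂ : ∀ {w} → w ∈ v₁ ∷ v₂ ∷ [] → Graph.Adj G u w
  adj-v₁,v₂ (here refl) = Graph.sym G v₁u
  adj-v₁,v₂ (there (here refl)) = Graph.sym G v₂u

module Extension {n : ℕ} (G : Graph n) (maxdeg : MaxDegreeAtMost G 3) (girth : GirthAtLeast G 7)
                 {v₁ v₂ u : Fin n} (around : Surroundings G v₁ v₂ u) where
  open Graph G renaming (sym to adj-sym)
  open Surroundings around

  ι : Node → Fin n
  ι = by-node u v₁ a b c v₂

  open Gluing _≟_ ι nodes ∈-nodes

  adj⇒≢ : ∀ {x y} → Adj x y → x ≢ y
  adj⇒≢ xy refl = irrefl xy

  deg₂≢deg₃ : ∀ {x y} → deg G x ≡ 2 → deg G y ≡ 3 → x ≢ y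
  deg₂≢deg₃ two three refl with trans (sym two) three
  ... | ()

  u≢v₁ : u ≢ v₁
  u≢v₁ = ≢-sym (adj⇒≢ v₁u)
  u≢v₂ : u ≢ v₂
  u≢v₂ = ≢-sym (adj⇒≢ v₂u)
  c≢v₁ : c ≢ v₁
  c≢v₁ = deg₂≢deg₃ deg-c deg-v₁
  c≢v₂ : c ≢ v₂
  c≢v₂ = ≢-sym (adj⇒≢ v₂c)

  record Side (x : Fin n) : Set where
    field
      v₁x : Adj v₁ x
      u≢x : u ≢ x
      deg-x : deg G x ≡ 2

  side-a : Side a
  side-a = record { v₁x = v₁a ; u≢x = u≢a ; deg-x = deg-a }

  side-b : Side b
  side-b = record { v₁x = v₁b ; u≢x = u≢b ; deg-x = deg-b }

  module SideAdjacency {x} (side : Side x) where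
    open Side side

    x≢v₁ : x ≢ v₁
    x≢v₁ = ≢-sym (adj⇒≢ v₁x)
    x≢v₂ : x ≢ v₂
    x≢v₂ = deg₂≢deg₃ deg-x deg-v₂

    x≁v₂ : ¬ Adj x v₂
    x≁v₂ xv₂ = girth _ (≤ᵇ⇒≤ _ _ _) (closed-walk-cycle G x (v₁ ∷ u ∷ v₂ ∷ [])
      ((x≢v₁ ∷ ≢-sym u≢x ∷ x≢v₂ ∷ []) ∷ (≢-sym u≢v₁ ∷ v₁≢v₂ ∷ []) ∷ (u≢v₂ ∷ []) ∷ [] ∷ [])
      (adj-sym v₁x ∷ v₁u ∷ adj-sym v₂u ∷ adj-sym xv₂ ∷ [-]))

    x≢c : x ≢ c
    x≢c refl = x≁v₂ (adj-sym v₂c)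

    u≁x : ¬ Adj u x
    u≁x ux with N[u] ux
    ... | here x≡v₁ = x≢v₁ x≡v₁
    ... | there (here x≡v₂) = x≢v₂ x≡v₂

  v₁≁c : ¬ Adj v₁ c
  v₁≁c v₁c with N[v₁] v₁c
  ... | here c≡b = SideAdjacency.x≢c side-b (sym c≡b)
  ... | there (here c≡a) = SideAdjacency.x≢c side-a (sym c≡a)
  ... | there (there (here c≡u)) = u≢c (sym c≡u)

  u≁c : ¬ Adj u c
  u≁c uc with N[u] uc
  ... | here c≡v₁ = c≢v₁ c≡v₁
  ... | there (here c≡v₂) = c≢v₂ c≡v₂

  v₁≁v₂ : ¬ Adj v₁ v₂
  v₁≁v₂ v₁v₂ with N[v₁] v₁v₂
  ... | here v₂≡b = SideAdjacency.x≢v₂ side-b (sym v₂≡b)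
  ... | there (here v₂≡a) = SideAdjacency.x≢v₂ side-a (sym v₂≡a)
  ... | there (there (here v₂≡u)) = u≢v₂ (sym v₂≡u)

  module SideSquare {x} (side : Side x) where
    open Side side
    open SideAdjacency side

    x≁c : ¬ Adj x c
    x≁c xc = girth _ (≤ᵇ⇒≤ _ _ _) (closed-walk-cycle G x (v₁ ∷ u ∷ v₂ ∷ c ∷ [])
      ((x≢v₁ ∷ ≢-sym u≢x ∷ x≢v₂ ∷ x≢c ∷ []) ∷ (≢-sym u≢v₁ ∷ v₁≢v₂ ∷ ≢-sym c≢v₁ ∷ [])
        ∷ (u≢v₂ ∷ u≢c ∷ []) ∷ (≢-sym c≢v₂ ∷ []) ∷ [] ∷ [])
      (adj-sym v₁x ∷ v₁u ∷ adj-sym v₂u ∷ v₂c ∷ adj-sym xc ∷ [-]))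

    x-w≁c : ∀ {w} → Adj x w → ¬ Adj w c
    x-w≁c {w} xw wc = girth _ (≤ᵇ⇒≤ _ _ _) (closed-walk-cycle G x (v₁ ∷ u ∷ v₂ ∷ c ∷ w ∷ [])
      ((x≢v₁ ∷ ≢-sym u≢x ∷ x≢v₂ ∷ x≢c ∷ adj⇒≢ xw ∷ [])
        ∷ (≢-sym u≢v₁ ∷ v₁≢v₂ ∷ ≢-sym c≢v₁ ∷ (λ { refl → v₁≁c wc }) ∷ [])
        ∷ (u≢v₂ ∷ u≢c ∷ (λ { refl → u≁c wc }) ∷ [])
        ∷ (≢-sym c≢v₂ ∷ (λ { refl → x≁v₂ xw }) ∷ [])
        ∷ (≢-sym (adj⇒≢ wc) ∷ []) ∷ [] ∷ [])
      (adj-sym v₁x ∷ v₁u ∷ adj-sym v₂u ∷ v₂c ∷ adj-sym wc ∷ adj-sym xw ∷ [-]))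

    x-w≁v₂ : ∀ {w} → Adj x w → ¬ Adj w v₂
    x-w≁v₂ {w} xw wv₂ = girth _ (≤ᵇ⇒≤ _ _ _) (closed-walk-cycle G x (v₁ ∷ u ∷ v₂ ∷ w ∷ [])
      ((x≢v₁ ∷ ≢-sym u≢x ∷ x≢v₂ ∷ adj⇒≢ xw ∷ [])
        ∷ (≢-sym u≢v₁ ∷ v₁≢v₂ ∷ (λ { refl → v₁≁v₂ wv₂ }) ∷ [])
        ∷ (u≢v₂ ∷ (λ { refl → u≁x (adj-sym xw) }) ∷ [])
        ∷ (≢-sym (adj⇒≢ wv₂) ∷ []) ∷ [] ∷ [])
      (adj-sym v₁x ∷ v₁u ∷ adj-sym v₂u ∷ adj-sym wv₂ ∷ adj-sym xw ∷ [-]))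

    x≁²c : ¬ SqAdj Adj x c
    x≁²c (_ , inj₁ xc) = x≁c xc
    x≁²c (_ , inj₂ (_ , xw , wc)) = x-w≁c xw wc

    x≁²v₂ : ¬ SqAdj Adj x v₂
    x≁²v₂ (_ , inj₁ xv₂) = x≁v₂ xv₂
    x≁²v₂ (_ , inj₂ (_ , xw , wv₂)) = x-w≁v₂ xw wv₂

  v₁≁²c : ¬ SqAdj Adj v₁ c
  v₁≁²c (_ , inj₁ v₁c) = v₁≁c v₁c
  v₁≁²c (_ , inj₂ (w , v₁w , wc)) with N[v₁] v₁w
  ... | here refl = SideSquare.x≁c side-b wc
  ... | there (here refl) = SideSquare.x≁c side-a wc
  ... | there (there (here refl)) = u≁c wc

  square-on-nodes : ∀ p q → SqAdj Adj (ι p) (ι q) → Edge p q ⊎ Edge q p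
  square-on-nodes U  U  (≢ , _) = ⊥-elim (≢ refl)
  square-on-nodes U  V₁ _ = inj₁ UV₁
  square-on-nodes U  A  _ = inj₁ UA
  square-on-nodes U  B  _ = inj₁ UB
  square-on-nodes U  C  _ = inj₁ UC
  square-on-nodes U  V₂ _ = inj₁ UV₂
  square-on-nodes V₁ U  _ = inj₂ UV₁
  square-on-nodes V₁ V₁ (≢ , _) = ⊥-elim (≢ refl)
  square-on-nodes V₁ A  _ = inj₁ V₁A
  square-on-nodes V₁ B  _ = inj₁ V₁B
  square-on-nodes V₁ C  sq = ⊥-elim (v₁≁²c sq)
  square-on-nodes V₁ V₂ _ = inj₁ V₁V₂
  square-on-nodes A  U  _ = inj₂ UA
  square-on-nodes A  V₁ _ = inj₂ V₁A
  square-on-nodes A  A  (≢ , _) = ⊥-elim (≢ refl)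
  square-on-nodes A  B  _ = inj₁ AB
  square-on-nodes A  C  sq = ⊥-elim (SideSquare.x≁²c side-a sq)
  square-on-nodes A  V₂ sq = ⊥-elim (SideSquare.x≁²v₂ side-a sq)
  square-on-nodes B  U  _ = inj₂ UB
  square-on-nodes B  V₁ _ = inj₂ V₁B
  square-on-nodes B  A  _ = inj₂ AB
  square-on-nodes B  B  (≢ , _) = ⊥-elim (≢ refl)
  square-on-nodes B  C  sq = ⊥-elim (SideSquare.x≁²c side-b sq)
  square-on-nodes B  V₂ sq = ⊥-elim (SideSquare.x≁²v₂ side-b sq)
  square-on-nodes C  U  _ = inj₂ UC
  square-on-nodes C  V₁ sq = ⊥-elim (v₁≁²c (SqAdj-sym G sq))
  square-on-nodes C  A  sq = ⊥-elim (SideSquare.x≁²c side-a (SqAdj-sym G sq))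
  square-on-nodes C  B  sq = ⊥-elim (SideSquare.x≁²c side-b (SqAdj-sym G sq))
  square-on-nodes C  C  (≢ , _) = ⊥-elim (≢ refl)
  square-on-nodes C  V₂ _ = inj₂ V₂C
  square-on-nodes V₂ U  _ = inj₂ UV₂
  square-on-nodes V₂ V₁ _ = inj₂ V₁V₂
  square-on-nodes V₂ A  sq = ⊥-elim (SideSquare.x≁²v₂ side-a (SqAdj-sym G sq))
  square-on-nodes V₂ B  sq = ⊥-elim (SideSquare.x≁²v₂ side-b (SqAdj-sym G sq))
  square-on-nodes V₂ C  _ = inj₁ V₂C
  square-on-nodes V₂ V₂ (≢ , _) = ⊥-elim (≢ refl)

  cover : Node → List (Fin n)
  cover U  = d ∷ []
  cover V₁ = a′ ∷ b′ ∷ []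
  cover A  = a′ ∷ without _≟_ a (nbrs G a′)
  cover B  = b′ ∷ without _≟_ b (nbrs G b′)
  cover C  = c′ ∷ d ∷ without _≟_ c (nbrs G c′)
  cover V₂ = d ∷ c′ ∷ without _≟_ v₂ (nbrs G d)

  cover-complete : ∀ p {y} → Outside y → SqAdj Adj (ι p) y → y ∈ cover p
  cover-complete U out (_ , inj₁ uy) = ⊥-elim (outside-∉ out (V₁ ∷ V₂ ∷ []) (N[u] uy))
  cover-complete U out (_ , inj₂ (w , uw , wy)) with N[u] uw
  ... | here refl = ⊥-elim (outside-∉ out (B ∷ A ∷ U ∷ []) (N[v₁] wy))
  ... | there (here refl) = here (outside-head out (C ∷ U ∷ []) (N[v₂] wy))
  cover-complete V₁ out (_ , inj₁ v₁y) = ⊥-elim (outside-∉ out (B ∷ A ∷ U ∷ []) (N[v₁] v₁y))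
  cover-complete V₁ out (_ , inj₂ (w , v₁w , wy)) with N[v₁] v₁w
  ... | here refl = there (here (outside-head out (V₁ ∷ []) (N[b] wy)))
  ... | there (here refl) = here (outside-head out (V₁ ∷ []) (N[a] wy))
  ... | there (there (here refl)) = ⊥-elim (outside-∉ out (V₁ ∷ V₂ ∷ []) (N[u] wy))
  cover-complete A out (_ , inj₁ ay) = here (outside-head out (V₁ ∷ []) (N[a] ay))
  cover-complete A out (_ , inj₂ (w , aw , wy)) with N[a] aw
  ... | here refl = there (∈-without⁺ _≟_ (∈-nbrs⁺ G wy) (out A))
  ... | there (here refl) = ⊥-elim (outside-∉ out (B ∷ A ∷ U ∷ []) (N[v₁] wy))
  cover-complete B out (_ , inj₁ by) = here (outside-head out (V₁ ∷ []) (N[b] by))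
  cover-complete B out (_ , inj₂ (w , bw , wy)) with N[b] bw
  ... | here refl = there (∈-without⁺ _≟_ (∈-nbrs⁺ G wy) (out B))
  ... | there (here refl) = ⊥-elim (outside-∉ out (B ∷ A ∷ U ∷ []) (N[v₁] wy))
  cover-complete C out (_ , inj₁ cy) = here (outside-head out (V₂ ∷ []) (N[c] cy))
  cover-complete C out (_ , inj₂ (w , cw , wy)) with N[c] cw
  ... | here refl = there (there (∈-without⁺ _≟_ (∈-nbrs⁺ G wy) (out C)))
  ... | there (here refl) = there (here (outside-head out (C ∷ U ∷ []) (N[v₂] wy)))
  cover-complete V₂ out (_ , inj₁ v₂y) = here (outside-head out (C ∷ U ∷ []) (N[v₂] v₂y))
  cover-complete V₂ out (_ , inj₂ (w , v₂w , wy)) with N[v₂] v₂w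
  ... | here refl = there (there (∈-without⁺ _≟_ (∈-nbrs⁺ G wy) (out V₂)))
  ... | there (here refl) = there (here (outside-head out (V₂ ∷ []) (N[c] wy)))
  ... | there (there (here refl)) = ⊥-elim (outside-∉ out (V₁ ∷ V₂ ∷ []) (N[u] wy))

  module Colours (L : Fin n → List ℕ) (L-six : IsKListAssignment 6 L) (f : Fin n → ℕ) (β : ℕ) where

    forbidden : Node → List ℕ
    forbidden U = β ∷ map f (cover U)
    forbidden p = map f (cover p)

    f-forbidden : ∀ p {y} → y ∈ cover p → f y ∈ forbidden p
    f-forbidden U  = there ∘ ∈-map⁺ f
    f-forbidden V₁ = ∈-map⁺ f
    f-forbidden A  = ∈-map⁺ f
    f-forbidden B  = ∈-map⁺ f
    f-forbidden C  = ∈-map⁺ f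
    f-forbidden V₂ = ∈-map⁺ f

    others-≤2 : ∀ {x y} → Adj x y → length (map f (without _≟_ y (nbrs G x))) ≤ 2
    others-≤2 {x} {y} xy = subst (_≤ 2) (sym (length-map f (without _≟_ y (nbrs G x))))
      (≤-pred (≤-trans (length-without _≟_ (∈-nbrs⁺ G xy)) (maxdeg x)))

    room : ∀ p → size p + length (forbidden p) ≤ 6
    room U  = ≤-refl
    room V₁ = ≤-refl
    room A  = +-monoʳ-≤ 4 (others-≤2 (adj-sym aa′))
    room B  = +-monoʳ-≤ 4 (others-≤2 (adj-sym bb′))
    room C  = +-monoʳ-≤ 4 (others-≤2 (adj-sym cc′))
    room V₂ = +-monoʳ-≤ 4 (others-≤2 (adj-sym v₂d))

    palettes : ∀ p → Palette _≟ℕ_ (size p) (L (ι p)) (forbidden p)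
    palettes p = palette _≟ℕ_ (size p) (proj₂ (L-six (ι p)))
      (subst (size p + length (forbidden p) ≤_) (sym (proj₁ (L-six (ι p)))) (room p))

    colouring : Colouring (Palette.colours ∘ palettes)
    colouring = configuration-choosable _≟ℕ_ (Palette.colours ∘ palettes)
      (Palette.unique ∘ palettes) (Palette.length≡ ∘ palettes)

    col : Node → ℕ
    col = proj₁ colouring

    col-sound : ∀ p → col p ∈ L (ι p) × col p ∉ forbidden p
    col-sound p = Palette.sound (palettes p) (proj₁ (proj₂ colouring) p)

    col-proper : ∀ {p q} → SqAdj Adj (ι p) (ι q) → col p ≢ col q
    col-proper {p} {q} sq = [ proper , (λ qp → proper qp ∘ sym) ]′ (square-on-nodes p q sq)
      where
      proper : ∀ {p q} → Edge p q → col p ≢ col q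
      proper = proj₂ (proj₂ colouring)

    col≢f : ∀ {p y} → Outside y → SqAdj Adj (ι p) y → col p ≢ f y
    col≢f {p} out sq col≡f =
      proj₂ (col-sound p) (subst (_∈ forbidden p) (sym col≡f) (f-forbidden p (cover-complete p out sq)))

    col≢β : ∀ q → ι q ≡ u → col q ≢ β
    col≢β U  _ = proj₂ (col-sound U) ∘ here
    col≢β V₁ v₁≡u = ⊥-elim (u≢v₁ (sym v₁≡u))
    col≢β A  a≡u = ⊥-elim (u≢a (sym a≡u))
    col≢β B  b≡u = ⊥-elim (u≢b (sym b≡u))
    col≢β C  c≡u = ⊥-elim (u≢c (sym c≡u))
    col≢β V₂ v₂≡u = ⊥-elim (u≢v₂ (sym v₂≡u))

  opaque
    extend : ∀ (L : Fin n → List ℕ) → IsKListAssignment 6 L → (f : Fin n → ℕ) →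
             (∀ x → Outside x → f x ∈ L x) →
             (∀ {x y} → Outside x → Outside y → SqAdj Adj x y → f x ≢ f y) →
             ∀ β → Σ (Fin n → ℕ) λ g → ProperLColoring AllV (SqAdj Adj) L g × g u ≢ β
    extend L L-six f f∈ f-proper β =
      glue col f ,
      ((λ x _ → glue-∈ col f L (proj₁ ∘ col-sound) f∈ x) ,
       (λ _ _ _ _ → glue-proper col f (SqAdj Adj) (SqAdj-sym G) col-proper col≢f f-proper)) ,
      glue-inside col f {P = _≢ β} U col≢β
      where
      open Colours L L-six f β

  extend-punctured : ∀ (L : Fin n → List ℕ) → IsKListAssignment 6 L →
    (∃ λ f → ProperLColoring (_≢ u) (SqAdj Adj) L f) →
    ∀ β → Σ (Fin n → ℕ) λ g → ProperLColoring AllV (SqAdj Adj) L g × g u ≢ β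
  extend-punctured L L-six (f , f∈ , f-proper) =
    extend L L-six f (λ x out → f∈ x (≢-sym (out U)))
      (λ {x} {y} out-x out-y → f-proper x y (≢-sym (out-x U)) (≢-sym (out-y U)))

  two-colourings : ∀ (L : Fin n → List ℕ) → IsKListAssignment 6 L →
    (∃ λ f → ProperLColoring (_≢ u) (SqAdj Adj) L f) →
    Σ (Fin n → ℕ) λ φ → Σ (Fin n → ℕ) λ ψ →
      ProperLColoring AllV (SqAdj Adj) L φ × ProperLColoring AllV (SqAdj Adj) L ψ × φ u ≢ ψ u
  two-colourings L L-six f with extend-punctured L L-six f 0
  ... | φ , φ-proper , _ with extend-punctured L L-six f (φ u)
  ... | ψ , ψ-proper , ψu≢φu = φ , ψ , φ-proper , ψ-proper , ψu≢φu ∘ sym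

  G-u : Subgraph G
  G-u = record
    { InV = _≢ u
    ; InE = λ x y → Adj x y × x ≢ u × y ≢ u
    ; E⊆Adj = proj₁
    ; Esym = λ (xy , x≢u , y≢u) → adj-sym xy , y≢u , x≢u
    ; Eends = λ (_ , x≢u , y≢u) → x≢u , y≢u }

  restrict-outside : ∀ {x y} → Outside x → Outside y → SqAdj Adj x y → SqAdj (Subgraph.InE G-u) x y
  restrict-outside out-x out-y (x≢y , inj₁ xy) = x≢y , inj₁ (xy , ≢-sym (out-x U) , ≢-sym (out-y U))
  restrict-outside out-x out-y (x≢y , inj₂ (w , xw , wy)) =
    x≢y , inj₂ (w , (xw , ≢-sym (out-x U) , w≢u) , (wy , w≢u , ≢-sym (out-y U)))
    where
    w≢u : w ≢ u
    w≢u refl = outside-∉ out-y (V₁ ∷ V₂ ∷ []) (N[u] wy)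

  not-minimal : ¬ Minimal 6 G
  not-minimal (not-choosable , minimal) = not-choosable extended
    where
    G-u-proper : Proper G-u
    G-u-proper (all-in , _) = all-in u refl
    extended : SquareChoosable 6 G
    extended L L-six with minimal G-u G-u-proper L L-six
    ... | f , f∈ , f-proper with extend L L-six f (λ x out → f∈ x (≢-sym (out U))) f-proper-outside 0
      where
      f-proper-outside : ∀ {x y} → Outside x → Outside y → SqAdj Adj x y → f x ≢ f y
      f-proper-outside {x} {y} out-x out-y =
        f-proper x y (≢-sym (out-x U)) (≢-sym (out-y U)) ∘ restrict-outside out-x out-y
    ... | g , g-proper , _ = g , g-proper

lemma17 :
    (∀ (n : ℕ) (G : Graph n) → Minimal 6 G → MaxDegreeAtMost G 3 → GirthAtLeast G 7 →
      ¬ (Σ (Fin n) λ v1 → Σ (Fin n) λ v2 → Σ (Fin n) λ u3 → Config G v1 v2 u3))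
    ×
    (∀ (n : ℕ) (G : Graph n) → MaxDegreeAtMost G 3 → GirthAtLeast G 7 →
      ∀ (v1 v2 u3 : Fin n) → Config G v1 v2 u3 →
      ∀ (L : Fin n → List ℕ) → IsKListAssignment 6 L →
      (∃ λ c → ProperLColoring (λ v → v ≢ u3) (SqAdj (Graph.Adj G)) L c) →
      Σ (Fin n → ℕ) λ φ → Σ (Fin n → ℕ) λ ψ →
        ProperLColoring AllV (SqAdj (Graph.Adj G)) L φ ×
        ProperLColoring AllV (SqAdj (Graph.Adj G)) L ψ × φ u3 ≢ ψ u3)
lemma17 =
  (λ n G minimal maxdeg girth (v₁ , v₂ , u , config) →
    Extension.not-minimal G maxdeg girth (surroundings G config) minimal) ,
  (λ n G maxdeg girth v₁ v₂ u config →
    Extension.two-colourings G maxdeg girth (surroundings G config))
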